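{- Let $n\ge 1$ and let $M=(m_{S,T})$ be the $(2^n-1)\times(2^n-1)$ matrix whose rows and columns are indexed by the nonempty subsets $S,T\subseteq\{1,\dots,n\}$, with $m_{S,T}=1$ if $S\cap T\neq\emptyset$ and $m_{S,T}=0$ otherwise. Then for every integer vector $r=(r_S)_{\emptyset\neq S\subseteq\{1,\dots,n\}}$ the linear system $Mx=r$ has a unique solution $x=(x_T)_{\emptyset\ne T\subseteq\{1,\dots,n\}}$, and this solution is integral.
   Context: Interpretation (not needed for the statement): for a single pixel encoded with $m$ subpixels on $n$ transparencies, $x_T$ is the number of subpixels that are black exactly on the transparencies with index in $T$, and $r_S$ is the number of black subpixels seen when the transparencies with indices in $S$ are stacked. -}

module Defs where

open import Data.Nat using (ℕ; zero; suc)
open import Data.Integer using (ℤ)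
open import Data.Rational using (ℚ; 0ℚ; 1ℚ; _+_; _*_; _/_)
open import Data.Bool using (true; false; if_then_else_)
open import Data.Vec using ([]; _∷_)
open import Data.List using (List; []; _∷_; [_]; map; _++_; mapMaybe; foldr)
open import Data.Maybe using (Maybe; just; nothing)
open import Data.Product using (Σ; _,_; proj₁)
open import Relation.Nullary using (yes; no; does)
open import Relation.Nullary.Decidable using (True; fromWitness)
open import Data.Fin.Subset using (Subset; inside; outside; _∩_)
open import Data.Fin.Subset.Properties using (nonempty?)

-- Nonempty subsets of {1,…,n} (= Fin n).  The witness `True (nonempty? S)`
-- is a unit/empty type, so each nonempty subset occurs exactly once.
NE : ℕ → Set
NE n = Σ (Subset n) (λ S → True (nonempty? S))

allSubsets : (n : ℕ) → List (Subset n)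
allSubsets zero = [ [] ]
allSubsets (suc n) = map (inside ∷_) (allSubsets n) ++ map (outside ∷_) (allSubsets n)

toNE : {n : ℕ} → Subset n → Maybe (NE n)
toNE S with nonempty? S
... | yes p = just (S , fromWitness p)
... | no _  = nothing

neSubsets : (n : ℕ) → List (NE n)
neSubsets n = mapMaybe toNE (allSubsets n)

entry : {n : ℕ} → NE n → NE n → ℚ
entry S T = if does (nonempty? (proj₁ S ∩ proj₁ T)) then 1ℚ else 0ℚ

Mx : {n : ℕ} → (NE n → ℚ) → NE n → ℚ
Mx {n} x S = foldr (λ T acc → entry S T * x T + acc) 0ℚ (neSubsets n)

ι : ℤ → ℚ
ι z = z / 1

{-# OPTIONS --safe #-}
-- Extend an unknown x to all subsets by x ∅ = − Σ_{T ≠ ∅} x T, so that its total sum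
-- vanishes. Since m_{S,T} = 1 − [S ∩ T = ∅], the system M x = r is then equivalent to
-- D x = −r for the disjointness operator (D x) S = Σ_{S ∩ T = ∅} x T on all subsets,
-- where r ∅ = 0 (row ∅ of D being the total sum). Splitting subsets by their first
-- element exhibits D as the Kronecker power of [[1,1],[1,0]], whose inverse
-- [[0,1],[1,−1]] is integral; so D is invertible over ℤ, which gives existence,
-- uniqueness and integrality at once.
module Submission where

open import Defs
open import Data.Nat using (ℕ; zero; suc; _≤_)
open import Data.Integer as ℤ using (ℤ; 0ℤ)
import Data.Integer.Tactic.RingSolver as ℤ-Solver
open import Data.Rational using (ℚ; 0ℚ; 1ℚ; _+_; _*_; _-_; -_; toℚᵘ)
open import Data.Rational.Properties
  using (toℚᵘ-injective; toℚᵘ-fromℚᵘ; toℚᵘ-homo-+; toℚᵘ-homo‿-;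
         +-identityˡ; +-identityʳ; +-assoc; +-inverseˡ; +-0-group; neg-injective)
import Data.Rational.Solver as ℚ-Solver
import Data.Rational.Unnormalised as ℚᵘ
import Data.Rational.Unnormalised.Properties as ℚᵘ
open import Algebra.Properties.Group +-0-group using (inverseˡ-unique)
open import Data.Bool using (true; false; if_then_else_)
open import Data.Bool.Properties using (T-irrelevant)
open import Data.Vec using ([]; _∷_; there)
open import Data.List using (List; []; _∷_; foldr; map; _++_; mapMaybe)
open import Data.Maybe using (Maybe; just; nothing; maybe′)
open import Data.Product using (Σ; _,_; proj₁; _×_)
open import Data.Fin using () renaming (suc to fsuc)
open import Data.Fin.Subset using (Subset; inside; outside; _∩_; ⊥; Nonempty)
open import Data.Fin.Subset.Properties using (nonempty?; ∉⊥; Empty-unique; ∩-zeroˡ; ∩-zeroʳ)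
open import Function using (_∘_; const; mk⇔)
open import Relation.Nullary using (yes; no; does; contradiction)
open import Relation.Nullary.Decidable using (does-⇔; dec-false; fromWitness; toWitness)
open import Relation.Binary.PropositionalEquality
  using (_≡_; refl; sym; trans; cong; cong₂; subst; module ≡-Reasoning)

ι-+ : ∀ a b → ι (a ℤ.+ b) ≡ ι a + ι b
ι-+ a b = toℚᵘ-injective (begin-equality
  toℚᵘ (ι (a ℤ.+ b))            ≃⟨ toℚᵘ-fromℚᵘ (ℚᵘ.mkℚᵘ (a ℤ.+ b) 0) ⟩
  ℚᵘ.mkℚᵘ (a ℤ.+ b) 0           ≃⟨ ℚᵘ.*≡* (cross-multiplied a b) ⟩
  ℚᵘ.mkℚᵘ a 0 ℚᵘ.+ ℚᵘ.mkℚᵘ b 0  ≃⟨ ℚᵘ.+-cong (toℚᵘ-fromℚᵘ (ℚᵘ.mkℚᵘ a 0)) (toℚᵘ-fromℚᵘ (ℚᵘ.mkℚᵘ b 0)) ⟨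
  toℚᵘ (ι a) ℚᵘ.+ toℚᵘ (ι b)    ≃⟨ toℚᵘ-homo-+ (ι a) (ι b) ⟨
  toℚᵘ (ι a + ι b)              ∎)
  where
  open ℚᵘ.≤-Reasoning
  cross-multiplied : ∀ a b → (a ℤ.+ b) ℤ.* ℤ.+ 1 ≡ (a ℤ.* ℤ.+ 1 ℤ.+ b ℤ.* ℤ.+ 1) ℤ.* ℤ.+ 1
  cross-multiplied = ℤ-Solver.solve-∀

ι-neg : ∀ a → ι (ℤ.- a) ≡ - ι a
ι-neg a = toℚᵘ-injective (begin-equality
  toℚᵘ (ι (ℤ.- a))          ≃⟨ toℚᵘ-fromℚᵘ (ℚᵘ.mkℚᵘ (ℤ.- a) 0) ⟩
  ℚᵘ.- ℚᵘ.mkℚᵘ a 0          ≃⟨ ℚᵘ.-‿cong (toℚᵘ-fromℚᵘ (ℚᵘ.mkℚᵘ a 0)) ⟨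
  ℚᵘ.- toℚᵘ (ι a)           ≃⟨ toℚᵘ-homo‿- (ι a) ⟨
  toℚᵘ (- ι a)              ∎)
  where open ℚᵘ.≤-Reasoning

ι-- : ∀ a b → ι (a ℤ.- b) ≡ ι a - ι b
ι-- a b = trans (ι-+ a (ℤ.- b)) (cong (ι a +_) (ι-neg b))

sumBy : {A : Set} → (A → ℚ) → List A → ℚ
sumBy f = foldr (λ a acc → f a + acc) 0ℚ

module _ {A : Set} where

  sumBy-cong : ∀ {f g : A → ℚ} → (∀ a → f a ≡ g a) → ∀ xs → sumBy f xs ≡ sumBy g xs
  sumBy-cong f≗g []       = refl
  sumBy-cong f≗g (x ∷ xs) = cong₂ _+_ (f≗g x) (sumBy-cong f≗g xs)

  sumBy-zero : ∀ xs → sumBy {A} (const 0ℚ) xs ≡ 0ℚ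
  sumBy-zero []       = refl
  sumBy-zero (x ∷ xs) = trans (+-identityˡ _) (sumBy-zero xs)

  sumBy-++ : ∀ (f : A → ℚ) xs ys → sumBy f (xs ++ ys) ≡ sumBy f xs + sumBy f ys
  sumBy-++ f []       ys = sym (+-identityˡ _)
  sumBy-++ f (x ∷ xs) ys = trans (cong (f x +_) (sumBy-++ f xs ys)) (sym (+-assoc (f x) _ _))

  sumBy-‿- : ∀ (f g : A → ℚ) xs → sumBy (λ a → f a - g a) xs ≡ sumBy f xs - sumBy g xs
  sumBy-‿- f g []       = refl
  sumBy-‿- f g (x ∷ xs) = trans (cong ((f x - g x) +_) (sumBy-‿- f g xs))
    (solve 4 (λ p q P Q → (p :- q) :+ (P :- Q) := (p :+ P) :- (q :+ Q)) refl
             (f x) (g x) (sumBy f xs) (sumBy g xs))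
    where open ℚ-Solver.+-*-Solver

  module _ {B : Set} where

    sumBy-map : ∀ (f : B → ℚ) (g : A → B) xs → sumBy f (map g xs) ≡ sumBy (f ∘ g) xs
    sumBy-map f g []       = refl
    sumBy-map f g (x ∷ xs) = cong (f (g x) +_) (sumBy-map f g xs)

    sumBy-mapMaybe : ∀ (f : B → ℚ) (g : A → Maybe B) xs →
      sumBy f (mapMaybe g xs) ≡ sumBy (maybe′ f 0ℚ ∘ g) xs
    sumBy-mapMaybe f g []       = refl
    sumBy-mapMaybe f g (x ∷ xs) with g x
    ... | just y  = cong (f y +_) (sumBy-mapMaybe f g xs)
    ... | nothing = trans (sumBy-mapMaybe f g xs) (sym (+-identityˡ _))

nonempty-outside : ∀ {n} (p : Subset n) → does (nonempty? (outside ∷ p)) ≡ does (nonempty? p)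
nonempty-outside p =
  does-⇔ (mk⇔ drop-outside (λ (i , i∈p) → fsuc i , there i∈p)) (nonempty? (outside ∷ p)) (nonempty? p)
  where
  drop-outside : Nonempty (outside ∷ p) → Nonempty p
  drop-outside (fsuc i , there i∈p) = i , i∈p

nonempty-⊥ : ∀ {n} → does (nonempty? (⊥ {n})) ≡ false
nonempty-⊥ {n} = dec-false (nonempty? (⊥ {n})) (λ (_ , x∈⊥) → ∉⊥ x∈⊥)

toNE-nonempty : ∀ {n} {S : Subset n} → Nonempty S →
  Σ (NE n) λ t → proj₁ t ≡ S × toNE S ≡ just t
toNE-nonempty {S = S} S≢∅ with nonempty? S
... | yes S≢∅′ = (S , fromWitness S≢∅′) , refl , refl
... | no S≡∅   = contradiction S≢∅ S≡∅

toNE-proj₁ : ∀ {n} (t : NE n) → toNE (proj₁ t) ≡ just t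
toNE-proj₁ (S , w) with toNE-nonempty (toWitness w)
... | (_ , w′) , refl , toNE-S = trans toNE-S (cong (λ v → just (S , v)) (T-irrelevant w′ w))

toNE-⊥ : ∀ {n} → toNE (⊥ {n}) ≡ nothing
toNE-⊥ {n} with nonempty? (⊥ {n})
... | yes (_ , x∈⊥) = contradiction x∈⊥ ∉⊥
... | no _          = refl

data EmptyOrNE {n} : Subset n → Set where
  empty    : EmptyOrNE ⊥
  nonempty : (t : NE n) → EmptyOrNE (proj₁ t)

emptyOrNE : ∀ {n} (T : Subset n) → EmptyOrNE T
emptyOrNE T with nonempty? T
... | yes T≢∅ = nonempty (T , fromWitness T≢∅)
... | no  T≡∅ = subst EmptyOrNE (sym (Empty-unique T≡∅)) empty

sumBy-allSubsets-suc : ∀ {n} (f : Subset (suc n) → ℚ) →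
  sumBy f (allSubsets (suc n)) ≡
  sumBy (f ∘ (inside ∷_)) (allSubsets n) + sumBy (f ∘ (outside ∷_)) (allSubsets n)
sumBy-allSubsets-suc {n} f = trans (sumBy-++ f (map (inside ∷_) (allSubsets n)) _)
  (cong₂ _+_ (sumBy-map f (inside ∷_) (allSubsets n)) (sumBy-map f (outside ∷_) (allSubsets n)))

sumBy-allSubsets : ∀ {n} (f : Subset n → ℚ) →
  sumBy f (allSubsets n) ≡ f ⊥ + sumBy (f ∘ proj₁) (neSubsets n)
sumBy-allSubsets {n} f = begin
  sumBy f (allSubsets n)                                     ≡⟨ split-off-⊥ n f ⟩
  f ⊥ + sumBy (onNonempty f) (allSubsets n)
    ≡⟨ cong (f ⊥ +_) (sumBy-cong onNonempty-toNE (allSubsets n)) ⟨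
  f ⊥ + sumBy (maybe′ (f ∘ proj₁) 0ℚ ∘ toNE) (allSubsets n)
    ≡⟨ cong (f ⊥ +_) (sumBy-mapMaybe (f ∘ proj₁) toNE (allSubsets n)) ⟨
  f ⊥ + sumBy (f ∘ proj₁) (neSubsets n)                      ∎
  where
  open ≡-Reasoning

  onNonempty : ∀ {m} → (Subset m → ℚ) → Subset m → ℚ
  onNonempty g T = if does (nonempty? T) then g T else 0ℚ

  onNonempty-toNE : ∀ T → maybe′ (f ∘ proj₁) 0ℚ (toNE T) ≡ onNonempty f T
  onNonempty-toNE T with nonempty? T
  ... | yes _ = refl
  ... | no _  = refl

  split-off-⊥ : ∀ m (g : Subset m → ℚ) →
    sumBy g (allSubsets m) ≡ g ⊥ + sumBy (onNonempty g) (allSubsets m)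
  split-off-⊥ zero    g = refl
  split-off-⊥ (suc m) g = begin
    sumBy g (allSubsets (suc m))  ≡⟨ sumBy-allSubsets-suc g ⟩
    Σᵢ + sumBy gₒ (allSubsets m)   ≡⟨ cong (Σᵢ +_) (split-off-⊥ m gₒ) ⟩
    Σᵢ + (gₒ ⊥ + Σₒ)               ≡⟨ solve 3 (λ a b c → a :+ (b :+ c) := b :+ (a :+ c)) refl Σᵢ (gₒ ⊥) Σₒ ⟩
    gₒ ⊥ + (Σᵢ + Σₒ)
      ≡⟨ cong (λ s → gₒ ⊥ + (Σᵢ + s)) (sumBy-cong onNonempty-outside (allSubsets m)) ⟨
    g ⊥ + (Σᵢ + sumBy (onNonempty g ∘ (outside ∷_)) (allSubsets m))
      ≡⟨ cong (g ⊥ +_) (sumBy-allSubsets-suc (onNonempty g)) ⟨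
    g ⊥ + sumBy (onNonempty g) (allSubsets (suc m))
      ∎
    where
    open ℚ-Solver.+-*-Solver
    gₒ : Subset m → ℚ
    gₒ = g ∘ (outside ∷_)
    Σᵢ Σₒ : ℚ
    Σᵢ = sumBy (g ∘ (inside ∷_)) (allSubsets m)
    Σₒ = sumBy (onNonempty gₒ) (allSubsets m)
    onNonempty-outside : ∀ T → onNonempty g (outside ∷ T) ≡ onNonempty gₒ T
    onNonempty-outside T = cong (if_then gₒ T else 0ℚ) (nonempty-outside T)

onDisjoint : ∀ {n} → Subset n → (Subset n → ℚ) → Subset n → ℚ
onDisjoint S g T = if does (nonempty? (S ∩ T)) then 0ℚ else g T

sumDisjoint : ∀ {n} → (Subset n → ℚ) → Subset n → ℚ
sumDisjoint {n} g S = sumBy (onDisjoint S g) (allSubsets n)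

module _ {n : ℕ} where

  sumDisjoint-cong : ∀ {g g′ : Subset n → ℚ} → (∀ T → g T ≡ g′ T) →
    ∀ S → sumDisjoint g S ≡ sumDisjoint g′ S
  sumDisjoint-cong g≗g′ S =
    sumBy-cong (λ T → cong (if does (nonempty? (S ∩ T)) then 0ℚ else_) (g≗g′ T)) (allSubsets n)

  sumDisjoint-⊥ : ∀ (g : Subset n → ℚ) → sumDisjoint g ⊥ ≡ sumBy g (allSubsets n)
  sumDisjoint-⊥ g = sumBy-cong ⊥-disjoint (allSubsets n)
    where
    ⊥-disjoint : ∀ T → onDisjoint ⊥ g T ≡ g T
    ⊥-disjoint T rewrite ∩-zeroˡ T | nonempty-⊥ {n} = refl

  private
    disjoint-outside : ∀ (g : Subset n → ℚ) S T →
      (if does (nonempty? (outside ∷ (S ∩ T))) then 0ℚ else g T) ≡ onDisjoint S g T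
    disjoint-outside g S T = cong (if_then 0ℚ else g T) (nonempty-outside (S ∩ T))

  sumDisjoint-inside : ∀ (g : Subset (suc n) → ℚ) S →
    sumDisjoint g (inside ∷ S) ≡ sumDisjoint (g ∘ (outside ∷_)) S
  sumDisjoint-inside g S = begin
    sumDisjoint g (inside ∷ S)
      ≡⟨ sumBy-allSubsets-suc (onDisjoint (inside ∷ S) g) ⟩
    sumBy (const 0ℚ) (allSubsets n) + _
      ≡⟨ cong₂ _+_ (sumBy-zero (allSubsets n)) (sumBy-cong (disjoint-outside _ S) (allSubsets n)) ⟩
    0ℚ + sumDisjoint (g ∘ (outside ∷_)) S
      ≡⟨ +-identityˡ _ ⟩
    sumDisjoint (g ∘ (outside ∷_)) S
      ∎
    where open ≡-Reasoning

  sumDisjoint-outside : ∀ (g : Subset (suc n) → ℚ) S →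
    sumDisjoint g (outside ∷ S) ≡ sumDisjoint (g ∘ (inside ∷_)) S + sumDisjoint (g ∘ (outside ∷_)) S
  sumDisjoint-outside g S = trans (sumBy-allSubsets-suc (onDisjoint (outside ∷ S) g))
    (cong₂ _+_ (sumBy-cong (disjoint-outside _ S) (allSubsets n))
               (sumBy-cong (disjoint-outside _ S) (allSubsets n)))

-- In the block form of sumDisjoint-outside and sumDisjoint-inside, D is [[1,1],[1,0]] ⊗ D;
-- invert it blockwise by [[0,1],[1,−1]].
sumDisjoint⁻¹ : ∀ {n} → (Subset n → ℤ) → Subset n → ℤ
sumDisjoint⁻¹ h []            = h []
sumDisjoint⁻¹ h (outside ∷ S) = sumDisjoint⁻¹ (h ∘ (inside ∷_)) S
sumDisjoint⁻¹ h (inside ∷ S)  = sumDisjoint⁻¹ (λ T → h (outside ∷ T) ℤ.- h (inside ∷ T)) S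

sumDisjoint-sumDisjoint⁻¹ : ∀ {n} (h : Subset n → ℤ) S →
  sumDisjoint (ι ∘ sumDisjoint⁻¹ h) S ≡ ι (h S)
sumDisjoint-sumDisjoint⁻¹ h []           = +-identityʳ _
sumDisjoint-sumDisjoint⁻¹ h (inside ∷ S) =
  trans (sumDisjoint-inside _ S) (sumDisjoint-sumDisjoint⁻¹ (h ∘ (inside ∷_)) S)
sumDisjoint-sumDisjoint⁻¹ h (outside ∷ S) = begin
  sumDisjoint (ι ∘ sumDisjoint⁻¹ h) (outside ∷ S)
    ≡⟨ sumDisjoint-outside _ S ⟩
  sumDisjoint (ι ∘ sumDisjoint⁻¹ h′) S + sumDisjoint (ι ∘ sumDisjoint⁻¹ hᵢ) S
    ≡⟨ cong₂ _+_ (sumDisjoint-sumDisjoint⁻¹ h′ S) (sumDisjoint-sumDisjoint⁻¹ hᵢ S) ⟩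
  ι (hₒ S ℤ.- hᵢ S) + ι (hᵢ S)
    ≡⟨ cong (_+ ι (hᵢ S)) (ι-- (hₒ S) (hᵢ S)) ⟩
  (ι (hₒ S) - ι (hᵢ S)) + ι (hᵢ S)
    ≡⟨ solve 2 (λ a b → (a :- b) :+ b := a) refl (ι (hₒ S)) (ι (hᵢ S)) ⟩
  ι (hₒ S)
    ∎
  where
  open ≡-Reasoning
  open ℚ-Solver.+-*-Solver
  hᵢ hₒ h′ : Subset _ → ℤ
  hᵢ = h ∘ (inside ∷_)
  hₒ = h ∘ (outside ∷_)
  h′ T = hₒ T ℤ.- hᵢ T

sumDisjoint⁻¹-unique : ∀ {n} (h : Subset n → ℤ) (y : Subset n → ℚ) →
  (∀ S → sumDisjoint y S ≡ ι (h S)) → ∀ T → y T ≡ ι (sumDisjoint⁻¹ h T)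
sumDisjoint⁻¹-unique h y y-sol []            = trans (sym (+-identityʳ _)) (y-sol [])
sumDisjoint⁻¹-unique h y y-sol (outside ∷ T) =
  sumDisjoint⁻¹-unique (h ∘ (inside ∷_)) (y ∘ (outside ∷_)) yₒ-sol T
  where
  yₒ-sol : ∀ S → sumDisjoint (y ∘ (outside ∷_)) S ≡ ι (h (inside ∷ S))
  yₒ-sol S = trans (sym (sumDisjoint-inside y S)) (y-sol (inside ∷ S))
sumDisjoint⁻¹-unique h y y-sol (inside ∷ T) =
  sumDisjoint⁻¹-unique (λ S → h (outside ∷ S) ℤ.- h (inside ∷ S)) (y ∘ (inside ∷_)) yᵢ-sol T
  where
  yᵢ-sol : ∀ S → sumDisjoint (y ∘ (inside ∷_)) S ≡ ι (h (outside ∷ S) ℤ.- h (inside ∷ S))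
  yᵢ-sol S = begin
    Dᵢ                                        ≡⟨ solve 2 (λ a b → a := (a :+ b) :- b) refl Dᵢ Dₒ ⟩
    (Dᵢ + Dₒ) - Dₒ                            ≡⟨ cong₂ _-_ (trans (sym (sumDisjoint-outside y S)) (y-sol (outside ∷ S)))
                                                           (trans (sym (sumDisjoint-inside y S)) (y-sol (inside ∷ S))) ⟩
    ι (h (outside ∷ S)) - ι (h (inside ∷ S))  ≡⟨ ι-- (h (outside ∷ S)) (h (inside ∷ S)) ⟨
    ι (h (outside ∷ S) ℤ.- h (inside ∷ S))    ∎
    where
    open ≡-Reasoning
    open ℚ-Solver.+-*-Solver
    Dᵢ Dₒ : ℚ
    Dᵢ = sumDisjoint (y ∘ (inside ∷_)) S
    Dₒ = sumDisjoint (y ∘ (outside ∷_)) S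

if-then-0-else : ∀ b q → (if b then 0ℚ else q) ≡ q - (if b then 1ℚ else 0ℚ) * q
if-then-0-else true  q = solve 1 (λ q → con 0ℚ := q :- con 1ℚ :* q) refl q
  where open ℚ-Solver.+-*-Solver
if-then-0-else false q = solve 1 (λ q → q := q :- con 0ℚ :* q) refl q
  where open ℚ-Solver.+-*-Solver

zeroSumExtension : ∀ {n} → (NE n → ℚ) → Subset n → ℚ
zeroSumExtension {n} y T = maybe′ y (- sumBy y (neSubsets n)) (toNE T)

module _ {n} (y : NE n → ℚ) where

  private
    ỹ : Subset n → ℚ
    ỹ = zeroSumExtension y
    Σy : ℚ
    Σy = sumBy y (neSubsets n)

  zeroSumExtension-proj₁ : ∀ t → zeroSumExtension y (proj₁ t) ≡ y t
  zeroSumExtension-proj₁ t = cong (maybe′ y (- Σy)) (toNE-proj₁ t)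

  zeroSumExtension-⊥ : zeroSumExtension y ⊥ ≡ - sumBy y (neSubsets n)
  zeroSumExtension-⊥ = cong (maybe′ y (- Σy)) toNE-⊥

  sum-zeroSumExtension : sumBy (zeroSumExtension y) (allSubsets n) ≡ 0ℚ
  sum-zeroSumExtension = begin
    sumBy ỹ (allSubsets n)
      ≡⟨ sumBy-allSubsets ỹ ⟩
    ỹ ⊥ + sumBy (ỹ ∘ proj₁) (neSubsets n)
      ≡⟨ cong₂ _+_ zeroSumExtension-⊥ (sumBy-cong zeroSumExtension-proj₁ (neSubsets n)) ⟩
    - Σy + Σy
      ≡⟨ +-inverseˡ Σy ⟩
    0ℚ
      ∎
    where open ≡-Reasoning

  sumDisjoint-zeroSumExtension : ∀ S → sumDisjoint (zeroSumExtension y) (proj₁ S) ≡ - Mx y S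
  sumDisjoint-zeroSumExtension S = begin
    sumDisjoint ỹ (proj₁ S)
      ≡⟨ sumBy-allSubsets (onDisjoint (proj₁ S) ỹ) ⟩
    onDisjoint (proj₁ S) ỹ ⊥ + sumBy (onDisjoint (proj₁ S) ỹ ∘ proj₁) (neSubsets n)
      ≡⟨ cong₂ _+_ ⊥-term (sumBy-cong NE-term (neSubsets n)) ⟩
    - Σy + sumBy (λ t → y t - entry S t * y t) (neSubsets n)
      ≡⟨ cong (- Σy +_) (sumBy-‿- y (λ t → entry S t * y t) (neSubsets n)) ⟩
    - Σy + (Σy - Mx y S)
      ≡⟨ solve 2 (λ a m → :- a :+ (a :- m) := :- m) refl Σy (Mx y S) ⟩
    - Mx y S
      ∎
    where
    open ≡-Reasoning
    open ℚ-Solver.+-*-Solver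
    ⊥-term : onDisjoint (proj₁ S) ỹ ⊥ ≡ - Σy
    ⊥-term rewrite ∩-zeroʳ (proj₁ S) | nonempty-⊥ {n} = zeroSumExtension-⊥
    NE-term : ∀ t → onDisjoint (proj₁ S) ỹ (proj₁ t) ≡ y t - entry S t * y t
    NE-term t = trans (cong (if b then 0ℚ else_) (zeroSumExtension-proj₁ t)) (if-then-0-else b (y t))
      where b = does (nonempty? (proj₁ S ∩ proj₁ t))

zeroSumExtension-restrict : ∀ {n} (g : Subset n → ℚ) → sumBy g (allSubsets n) ≡ 0ℚ →
  ∀ T → zeroSumExtension (g ∘ proj₁) T ≡ g T
zeroSumExtension-restrict g Σg≡0 T with emptyOrNE T
... | empty      = trans (zeroSumExtension-⊥ (g ∘ proj₁))
                     (sym (inverseˡ-unique (g ⊥) _ (trans (sym (sumBy-allSubsets g)) Σg≡0)))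
... | nonempty t = zeroSumExtension-proj₁ (g ∘ proj₁) t

module _ {n} (r : NE n → ℚ) where

  Mx≡⇒sumDisjoint≡ : ∀ y → (∀ S → Mx y S ≡ r S) →
    ∀ T → sumDisjoint (zeroSumExtension y) T ≡ maybe′ (-_ ∘ r) 0ℚ (toNE T)
  Mx≡⇒sumDisjoint≡ y y-sol T with emptyOrNE T
  ... | empty      rewrite toNE-⊥ {n}   =
    trans (sumDisjoint-⊥ (zeroSumExtension y)) (sum-zeroSumExtension y)
  ... | nonempty t rewrite toNE-proj₁ t =
    trans (sumDisjoint-zeroSumExtension y t) (cong -_ (y-sol t))

  sumDisjoint≡⇒Mx≡ : ∀ g → (∀ T → sumDisjoint g T ≡ maybe′ (-_ ∘ r) 0ℚ (toNE T)) →
    ∀ S → Mx (g ∘ proj₁) S ≡ r S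
  sumDisjoint≡⇒Mx≡ g g-sol S = neg-injective (begin
    - Mx (g ∘ proj₁) S
      ≡⟨ sumDisjoint-zeroSumExtension (g ∘ proj₁) S ⟨
    sumDisjoint (zeroSumExtension (g ∘ proj₁)) (proj₁ S)
      ≡⟨ sumDisjoint-cong (zeroSumExtension-restrict g Σg≡0) (proj₁ S) ⟩
    sumDisjoint g (proj₁ S)
      ≡⟨ g-sol (proj₁ S) ⟩
    maybe′ (-_ ∘ r) 0ℚ (toNE (proj₁ S))
      ≡⟨ cong (maybe′ (-_ ∘ r) 0ℚ) (toNE-proj₁ S) ⟩
    - r S
      ∎)
    where
    open ≡-Reasoning
    Σg≡0 : sumBy g (allSubsets n) ≡ 0ℚ
    Σg≡0 = trans (sym (sumDisjoint-⊥ g)) (trans (g-sol ⊥) (cong (maybe′ (-_ ∘ r) 0ℚ) toNE-⊥))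

mainTheorem1 : (n : ℕ) → 1 ≤ n → (r : NE n → ℤ) →
    Σ (NE n → ℤ) (λ x →
      ((S : NE n) → Mx (λ T → ι (x T)) S ≡ ι (r S)) ×
      ((y : NE n → ℚ) → ((S : NE n) → Mx y S ≡ ι (r S)) → (T : NE n) → y T ≡ ι (x T)))
mainTheorem1 n _ r = x , x-solves , x-unique
  where
  h : Subset n → ℤ
  h T = maybe′ (ℤ.-_ ∘ r) 0ℤ (toNE T)

  x : NE n → ℤ
  x = sumDisjoint⁻¹ h ∘ proj₁

  ι∘h : ∀ T → ι (h T) ≡ maybe′ (-_ ∘ ι ∘ r) 0ℚ (toNE T)
  ι∘h T with toNE T
  ... | just t  = ι-neg (r t)
  ... | nothing = refl

  x-solves : ∀ S → Mx (ι ∘ x) S ≡ ι (r S)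
  x-solves = sumDisjoint≡⇒Mx≡ (ι ∘ r) (ι ∘ sumDisjoint⁻¹ h)
    (λ T → trans (sumDisjoint-sumDisjoint⁻¹ h T) (ι∘h T))

  x-unique : ∀ y → (∀ S → Mx y S ≡ ι (r S)) → ∀ T → y T ≡ ι (x T)
  x-unique y y-sol T = trans (sym (zeroSumExtension-proj₁ y T))
    (sumDisjoint⁻¹-unique h (zeroSumExtension y)
      (λ S → trans (Mx≡⇒sumDisjoint≡ (ι ∘ r) y y-sol S) (sym (ι∘h S))) (proj₁ T))
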